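{- Let $n\ge1$. For each $q\in\{1,2,\ldots,c_n-1\}$, the permutation $\mathcal{D}_n(q+1)$ is obtained from $\mathcal{D}_n(q)$ by a rotation of two, three or four elements, i.e. by cyclically permuting the entries occupying some set of two, three or four positions (in particular, $\mathcal{D}_n(q)$ and $\mathcal{D}_n(q+1)$ differ in at most four positions).
   Context: Let $c_n=\frac{1}{n+1}\binom{2n}{n}$ be the $n$-th Catalan number. Let $A(1)=0$ and $A(i)=c_0+c_1+\cdots+c_{i-2}$ for $i>1$. Lists of permutations are written as ordered sequences; the $j$-th entry of a list $\mathcal{D}_n$ is $\mathcal{D}_n(j)$. For a positive integer $i$, $\mathcal{D}_n^i$ denotes $\mathcal{D}_n$ if $i$ is odd and the reversal of $\mathcal{D}_n$ if $i$ is even, so $\mathcal{D}_n^i(j)=\mathcal{D}_n^{i+1}(c_n+1-j)$. For a permutation (word) $w$ and integer $l$, $w+l$ denotes $w$ with every entry increased by $l$. $[\alpha,n,\beta]$ denotes the word obtained by concatenating the word $\alpha$, the letter $n$, and the word $\beta$; concatenation with the empty permutation $\emptyset$ leaves a word unchanged. $\bigoplus$ denotes concatenation of lists in the order of the indices (outer index varying slowest). Define $\mathcal{D}_0=(\emptyset)$ and for $n\ge1$ $$\mathcal{D}_n=\bigoplus_{i=1}^{n}\bigoplus_{j=1}^{c_{i-1}}\bigoplus_{k=1}^{c_{n-i}}\left[\mathcal{D}_{i-1}^{\,n+i-1}(j),\ n,\ \mathcal{D}_{n-i}^{\,j+A(i)+1}(k)+(i-1)\right].$$ (The list $\mathcal{D}_n$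 consists of the $231$-avoiding permutations of $\{1,\ldots,n\}$.) -}

module Defs where

open import Data.Nat using (ℕ; zero; suc; _+_; _*_; _∸_; _≤_; _<_; _≤ᵇ_; _%_)
open import Data.Nat.Combinatorics using (_C_)
open import Data.Nat.DivMod using (_/_)
open import Data.Bool using (Bool; true; false; if_then_else_)
open import Data.List using (List; []; _∷_; _++_; [_]; map; concatMap; upTo; reverse; length)
open import Data.Nat.ListAction using (sum)
open import Data.Product using (Σ; _×_)
open import Relation.Binary.PropositionalEquality using (_≡_; _≢_)

catalan : ℕ → ℕ
catalan n = ((2 * n) C n) / suc n

A : ℕ → ℕ
A i = sum (map catalan (upTo (i ∸ 1)))

range1 : ℕ → List ℕ
range1 b = map suc (upTo b)

-- 1-based lookup in a list; out-of-range gives the default d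
at : {X : Set} → X → List X → ℕ → X
at d []       _             = d
at d (x ∷ xs) zero          = d
at d (x ∷ xs) (suc zero)    = x
at d (x ∷ xs) (suc (suc j)) = at d xs (suc j)

isOdd : ℕ → Bool
isOdd zero = false
isOdd (suc n) = not (isOdd n)
  where
  not : Bool → Bool
  not true = false
  not false = true

pow : ℕ → List (List ℕ) → List (List ℕ)
pow p L = if isOdd p then L else reverse L

shift : ℕ → List ℕ → List ℕ
shift l = map (_+ l)

-- One step of the recursive construction of D_n, given E m = D_m for m < n.
step : ℕ → (ℕ → List (List ℕ)) → List (List ℕ)
step n E =
  concatMap (λ i →
    concatMap (λ j →
      map (λ k →
        at [] (pow (n + i ∸ 1) (E (i ∸ 1))) j
          ++ [ n ] ++
        shift (i ∸ 1) (at [] (pow (j + A i + 1) (E (n ∸ i))) k))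
      (range1 (catalan (n ∸ i))))
    (range1 (catalan (i ∸ 1))))
  (range1 n)

-- Dupto n m = D_m for all m ≤ n
Dupto : ℕ → ℕ → List (List ℕ)
Dupto zero    m = [ [] ]
Dupto (suc n) m = if m ≤ᵇ n then Dupto n m else step (suc n) (Dupto n)

-- The list D_n of 231-avoiding permutations of {1..n}
D : ℕ → List (List ℕ)
D n = Dupto n n

Dat : ℕ → ℕ → List ℕ
Dat n j = at [] (D n) j

-- 0-based entry of a word (default 0 out of range)
entry : List ℕ → ℕ → ℕ
entry []       _       = 0
entry (x ∷ xs) zero    = x
entry (x ∷ xs) (suc i) = entry xs i

-- v is obtained from u by a rotation of the m = k+2 entries at the distinct
-- positions p 0, ..., p (m-1) (0-based): the entry of u at p t moves to
-- position p ((t+1) mod m), and all other entries are unchanged.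
RotationOf : ℕ → List ℕ → List ℕ → Set
RotationOf k u v =
  length u ≡ length v ×
  Σ (ℕ → ℕ) λ p →
    (∀ s t → s < suc (suc k) → t < suc (suc k) → p s ≡ p t → s ≡ t) ×
    (∀ t → t < suc (suc k) → p t < length u) ×
    (∀ t → t < suc (suc k) → entry v (p ((suc t) % (suc (suc k)))) ≡ entry u (p t)) ×
    (∀ x → x < length u → (∀ t → t < suc (suc k) → x ≢ p t) → entry v x ≡ entry u x)

Rotation234 : List ℕ → List ℕ → Set
Rotation234 u v = Σ ℕ λ k → k ≤ 2 × RotationOf k u v

module Submission where

-- Each word of D n is α ++ [ n ] ++ β with α taken from D (i − 1) and β from D (n − i), shifted by i − 1.
-- By induction on m, D m has catalan m words, runs from m 1 2 … m−1 to 1 2 … m, and consecutive words differ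
-- by a rotation of two, three or four entries.  Inside a block only α or only β changes, by one step of a smaller
-- list read forwards or backwards, and rotations survive prefixing, suffixing and shifting.  The parities in the
-- exponents make each reversed copy of D (n − i) start where the previous copy ended; between blocks i and i + 1
-- both factors sit at ends of their lists, words 1 2 … m or m 1 2 … m−1, and the change moves the letter i + 1
-- (and possibly i) across n.  The count catalan n is Segner's recurrence, derived from (2n choose n)/(n + 1)
-- through ballot numbers.

open import Defs
open import Algebra.Properties.CommutativeSemigroup using (interchange)
open import Data.Bool using (Bool; true; false; if_then_else_; not)
open import Data.Bool.Properties using (not-involutive; T-≡)
open import Data.Empty using (⊥-elim)
open import Data.List using (List; []; _∷_; _++_; [_]; _∷ʳ_; map; concatMap; reverse; length; applyUpTo; upTo)
open import Data.List.Properties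
  using (length-++; length-map; ++-identityʳ; ++-assoc; unfold-reverse; length-reverse; length-applyUpTo;
         map-applyUpTo; map-∘; map-++; map-cong; map-id; concatMap-map; applyUpTo-∷ʳ)
open import Data.Nat using (ℕ; zero; suc; _+_; _*_; _∸_; _≤_; _<_; z≤n; s≤s; _%_; _≤ᵇ_)
open import Data.Nat.Combinatorics using (_C_; nCk+nC[k+1]≡[n+1]C[k+1]; nCk≡nC[n∸k]; nC1≡n; k>n⇒nCk≡0)
open import Data.Nat.DivMod using (_/_; m*n/n≡m; m<n⇒m%n≡m; n%n≡0; m%n<n)
open import Data.Nat.Induction using (<-rec)
open import Data.Nat.ListAction using (sum)
open import Data.Nat.ListAction.Properties using (sum-++)
open import Data.Nat.Properties
open import Data.Nat.Solver using (module +-*-Solver)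
open import Data.Product using (Σ; _×_; _,_; proj₁; proj₂; map₂)
open import Data.Sum using (_⊎_; inj₁; inj₂)
open import Function using (_∘_)
open import Function.Bundles using (Equivalence)
open import Relation.Binary.Definitions using (Symmetric)
open import Relation.Binary.PropositionalEquality hiding ([_])
open import Relation.Nullary using (yes; no)
open +-*-Solver using (solve; _:+_; _:*_; _:=_; con)

∑ : ℕ → (ℕ → ℕ) → ℕ
∑ zero    f = 0
∑ (suc n) f = f 0 + ∑ n (f ∘ suc)

syntax ∑ n (λ k → e) = ∑[ k < n ] e

∑-cong : ∀ n {f g : ℕ → ℕ} → (∀ k → k < n → f k ≡ g k) → ∑ n f ≡ ∑ n g
∑-cong zero    f≡g = refl
∑-cong (suc n) f≡g = cong₂ _+_ (f≡g 0 (s≤s z≤n)) (∑-cong n (λ k k<n → f≡g (suc k) (s≤s k<n)))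

∑-last : ∀ n (f : ℕ → ℕ) → ∑ (suc n) f ≡ ∑ n f + f n
∑-last zero    f = +-identityʳ (f 0)
∑-last (suc n) f = trans (cong (f 0 +_) (∑-last n (f ∘ suc))) (sym (+-assoc (f 0) _ _))

∑-+ : ∀ n (f g : ℕ → ℕ) → ∑[ k < n ] (f k + g k) ≡ ∑ n f + ∑ n g
∑-+ zero    f g = refl
∑-+ (suc n) f g = trans (cong (f 0 + g 0 +_) (∑-+ n (f ∘ suc) (g ∘ suc)))
  (interchange +-commutativeSemigroup (f 0) (g 0) (∑ n (f ∘ suc)) (∑ n (g ∘ suc)))

∑-const : ∀ n c → ∑[ k < n ] c ≡ n * c
∑-const zero    c = refl
∑-const (suc n) c = cong (c +_) (∑-const n c)

∑-evens : ∀ n (f : ℕ → ℕ) → (∀ i → f (suc (2 * i)) ≡ 0) →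
          ∑ (suc (2 * n)) f ≡ ∑[ i < suc n ] f (2 * i)
∑-evens zero    f odd≡0 = refl
∑-evens (suc n) f odd≡0 = begin
    ∑ (suc (2 * suc n)) f
  ≡⟨ cong (λ m → ∑ (suc m) f) (*-suc 2 n) ⟩
    f 0 + (f 1 + ∑ (suc (2 * n)) (f ∘ suc ∘ suc))
  ≡⟨ cong (λ x → f 0 + (x + ∑ (suc (2 * n)) (f ∘ suc ∘ suc))) (odd≡0 0) ⟩
    f 0 + ∑ (suc (2 * n)) (f ∘ suc ∘ suc)
  ≡⟨ cong (f 0 +_) (∑-evens n (f ∘ suc ∘ suc) (λ i → trans (cong (f ∘ suc) (sym (*-suc 2 i)))
                                                              (odd≡0 (suc i)))) ⟩
    f 0 + ∑[ i < suc n ] f (suc (suc (2 * i)))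
  ≡⟨ cong (f 0 +_) (∑-cong (suc n) (λ i _ → cong f (sym (*-suc 2 i)))) ⟩
    ∑[ i < suc (suc n) ] f (2 * i) ∎
  where open ≡-Reasoning

-- Ballot numbers and Segner's recurrence

[1+k]*nC[1+k]≡[n∸k]*nCk : ∀ n k → suc k * (n C suc k) ≡ (n ∸ k) * (n C k)
[1+k]*nC[1+k]≡[n∸k]*nCk zero    k    = trans (*-zeroʳ (suc k)) (cong (_* (0 C k)) (sym (0∸n≡0 k)))
[1+k]*nC[1+k]≡[n∸k]*nCk (suc n) zero = trans (+-identityʳ _) (trans (nC1≡n (suc n)) (sym (*-identityʳ (suc n))))
[1+k]*nC[1+k]≡[n∸k]*nCk (suc n) (suc k) = begin
    suc (suc k) * (suc n C suc (suc k))
  ≡⟨ cong (suc (suc k) *_) (sym (nCk+nC[k+1]≡[n+1]C[k+1] n (suc k))) ⟩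
    suc (suc k) * (X + Y)
  ≡⟨ *-distribˡ-+ (suc (suc k)) X Y ⟩
    (X + suc k * X) + suc (suc k) * Y
  ≡⟨ cong₂ (λ a b → (X + a) + b) ([1+k]*nC[1+k]≡[n∸k]*nCk n k) ([1+k]*nC[1+k]≡[n∸k]*nCk n (suc k)) ⟩
    (X + (n ∸ k) * Z) + (n ∸ suc k) * X
  ≡⟨ solve 3 (λ x a b → (x :+ a) :+ b := a :+ (x :+ b)) refl X ((n ∸ k) * Z) ((n ∸ suc k) * X) ⟩
    (n ∸ k) * Z + (X + (n ∸ suc k) * X)
  ≡⟨ cong ((n ∸ k) * Z +_) X+[n∸1+k]*X ⟩
    (n ∸ k) * Z + (n ∸ k) * X
  ≡⟨ sym (*-distribˡ-+ (n ∸ k) Z X) ⟩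
    (n ∸ k) * (Z + X)
  ≡⟨ cong ((n ∸ k) *_) (nCk+nC[k+1]≡[n+1]C[k+1] n k) ⟩
    (n ∸ k) * (suc n C suc k) ∎
  where
  open ≡-Reasoning
  X = n C suc k
  Y = n C suc (suc k)
  Z = n C k
  X+[n∸1+k]*X : X + (n ∸ suc k) * X ≡ (n ∸ k) * X
  X+[n∸1+k]*X with k <? n
  ... | yes k<n = cong (_* X) (sym (+-∸-assoc 1 k<n))
  ... | no  k≮n rewrite k>n⇒nCk≡0 {n} {suc k} (s≤s (≮⇒≥ k≮n)) =
    trans (*-zeroʳ (n ∸ suc k)) (sym (*-zeroʳ (n ∸ k)))

-- ballot m h counts the paths of m steps ±1 from height h down to height 0 that never go below 0.
ballot : ℕ → ℕ → ℕ
ballot zero    zero    = 1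
ballot zero    (suc h) = 0
ballot (suc m) zero    = ballot m 1
ballot (suc m) (suc h) = ballot m h + ballot m (suc (suc h))

ballot-unreachable : ∀ m h → m < h → ballot m h ≡ 0
ballot-unreachable zero    (suc h) _         = refl
ballot-unreachable (suc m) (suc h) (s≤s m<h) =
  cong₂ _+_ (ballot-unreachable m h m<h) (ballot-unreachable m (suc (suc h)) (m<n⇒m<1+n (m<n⇒m<1+n m<h)))

ballot-diagonal : ∀ h → ballot h h ≡ 1
ballot-diagonal zero    = refl
ballot-diagonal (suc h) =
  cong₂ _+_ (ballot-diagonal h) (ballot-unreachable h (suc (suc h)) (m<n⇒m<1+n (n<1+n h)))

data Odd : ℕ → Set where
  one : Odd 1
  2+  : ∀ {n} → Odd n → Odd (suc (suc n))

Odd-1+2* : ∀ i → Odd (suc (2 * i))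
Odd-1+2* zero    = one
Odd-1+2* (suc i) = subst Odd (cong suc (sym (*-suc 2 i))) (2+ (Odd-1+2* i))

ballot-odd : ∀ m h → Odd (m + h) → ballot m h ≡ 0
ballot-odd zero    (suc h) _ = refl
ballot-odd (suc m) zero    o = ballot-odd m 1 (subst Odd (trans (+-identityʳ (suc m)) (+-comm 1 m)) o)
ballot-odd (suc m) (suc h) o =
  cong₂ _+_ (ballot-odd m h o′) (ballot-odd m (suc (suc h)) (subst Odd (sym m+[2+h]≡2+m+h) (2+ o′)))
  where
  m+[2+h]≡2+m+h : m + suc (suc h) ≡ suc (suc (m + h))
  m+[2+h]≡2+m+h = trans (+-suc m (suc h)) (cong suc (+-suc m h))
  o′ : Odd (m + h)
  o′ with subst Odd (cong suc (+-suc m h)) o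
  ... | 2+ o′ = o′

-- Split a path from h + 1 at its first visit to h: before it lies an excursion of some length j above h + 1.
ballot-firstPassage : ∀ m h → ballot (suc m) (suc h) ≡ ∑[ j < suc m ] (ballot j 0 * ballot (m ∸ j) h)
ballot-firstPassage zero    h = sym (+-identityʳ _)
ballot-firstPassage (suc m) h = sym (begin
    ∑[ j < suc (suc m) ] (ballot j 0 * ballot (suc m ∸ j) h)
  ≡⟨ ∑-last (suc m) (λ j → ballot j 0 * ballot (suc m ∸ j) h) ⟩
    ∑[ j < suc m ] (ballot j 0 * ballot (suc m ∸ j) h) + ballot (suc m) 0 * ballot (m ∸ m) h
  ≡⟨ cong₂ (λ a b → a + ballot (suc m) 0 * ballot b h)
       (∑-cong (suc m) (λ j j≤m → cong (λ x → ballot j 0 * ballot x h) (+-∸-assoc 1 (≤-pred j≤m))))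
       (n∸n≡0 m) ⟩
    ∑[ j < suc m ] (ballot j 0 * ballot (suc (m ∸ j)) h) + ballot (suc m) 0 * ballot 0 h
  ≡⟨ split h ⟩
    ballot (suc (suc m)) (suc h) ∎)
  where
  open ≡-Reasoning
  split : ∀ h → ∑[ j < suc m ] (ballot j 0 * ballot (suc (m ∸ j)) h) + ballot (suc m) 0 * ballot 0 h
              ≡ ballot (suc (suc m)) (suc h)
  split zero = begin
      ∑[ j < suc m ] (ballot j 0 * ballot (m ∸ j) 1) + ballot (suc m) 0 * 1
    ≡⟨ cong₂ _+_ (sym (ballot-firstPassage m 1)) (*-identityʳ _) ⟩
      ballot (suc m) 2 + ballot (suc m) 0
    ≡⟨ +-comm (ballot (suc m) 2) (ballot (suc m) 0) ⟩
      ballot (suc m) 0 + ballot (suc m) 2 ∎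
  split (suc h) = begin
      ∑[ j < suc m ] (ballot j 0 * (B j h + B j (suc (suc h)))) + ballot (suc m) 0 * 0
    ≡⟨ cong₂ _+_ (∑-cong (suc m) (λ j _ → *-distribˡ-+ (ballot j 0) (B j h) (B j (suc (suc h)))))
                 (*-zeroʳ (ballot (suc m) 0)) ⟩
      ∑[ j < suc m ] (ballot j 0 * B j h + ballot j 0 * B j (suc (suc h))) + 0
    ≡⟨ +-identityʳ _ ⟩
      ∑[ j < suc m ] (ballot j 0 * B j h + ballot j 0 * B j (suc (suc h)))
    ≡⟨ ∑-+ (suc m) (λ j → ballot j 0 * B j h) (λ j → ballot j 0 * B j (suc (suc h))) ⟩
      ∑[ j < suc m ] (ballot j 0 * B j h) + ∑[ j < suc m ] (ballot j 0 * B j (suc (suc h)))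
    ≡⟨ cong₂ _+_ (sym (ballot-firstPassage m h)) (sym (ballot-firstPassage m (suc (suc h)))) ⟩
      ballot (suc (suc m)) (suc (suc h)) ∎
    where
    B : ℕ → ℕ → ℕ
    B j = ballot (m ∸ j)

-- The reflection principle ballot N h = N C (b + 1) − N C b for N = h + 2 (b + 1), stated without subtraction.
ballot-reflection : ∀ b h → ballot (h + 2 * suc b) h + (h + 2 * suc b) C b ≡ (h + 2 * suc b) C suc b
ballot-reflection zero zero = refl
ballot-reflection zero (suc h) = begin
    (ballot M h + ballot M (suc (suc h))) + 1
  ≡⟨ cong (λ x → ballot M h + x + 1) ballot[M,2+h]≡1 ⟩
    ballot M h + 1 + 1
  ≡⟨ cong (_+ 1) (trans (ballot-reflection zero h) (nC1≡n M)) ⟩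
    M + 1
  ≡⟨ +-comm M 1 ⟩
    suc M
  ≡⟨ sym (nC1≡n (suc M)) ⟩
    suc M C 1 ∎
  where
  open ≡-Reasoning
  M = h + 2 * 1
  ballot[M,2+h]≡1 : ballot M (suc (suc h)) ≡ 1
  ballot[M,2+h]≡1 = trans (cong (λ y → ballot y (suc (suc h))) (+-comm h 2)) (ballot-diagonal (suc (suc h)))
ballot-reflection (suc b) zero = begin
    ballot (2 * suc (suc b)) 0 + (2 * suc (suc b)) C suc b
  ≡⟨ cong (λ z → ballot z 0 + z C suc b) 2*[2+b]≡1+K ⟩
    ballot K 1 + suc K C suc b
  ≡⟨ cong (ballot K 1 +_) (sym (nCk+nC[k+1]≡[n+1]C[k+1] K b)) ⟩
    ballot K 1 + (K C b + K C suc b)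
  ≡⟨ sym (+-assoc (ballot K 1) (K C b) (K C suc b)) ⟩
    (ballot K 1 + K C b) + K C suc b
  ≡⟨ cong (_+ K C suc b) (ballot-reflection b 1) ⟩
    K C suc b + K C suc b
  ≡⟨ cong (K C suc b +_) KC[1+b]≡KC[2+b] ⟩
    K C suc b + K C suc (suc b)
  ≡⟨ nCk+nC[k+1]≡[n+1]C[k+1] K (suc b) ⟩
    suc K C suc (suc b)
  ≡⟨ cong (λ z → z C suc (suc b)) (sym 2*[2+b]≡1+K) ⟩
    (2 * suc (suc b)) C suc (suc b) ∎
  where
  open ≡-Reasoning
  K = 1 + 2 * suc b
  2*[2+b]≡1+K : 2 * suc (suc b) ≡ suc K
  2*[2+b]≡1+K = solve 1 (λ b → con 2 :* (con 2 :+ b) := con 2 :+ con 2 :* (con 1 :+ b)) refl b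
  K≡[1+b]+[2+b] : K ≡ suc b + suc (suc b)
  K≡[1+b]+[2+b] = solve 1 (λ b → con 1 :+ con 2 :* (con 1 :+ b) := (con 1 :+ b) :+ (con 2 :+ b)) refl b
  KC[1+b]≡KC[2+b] : K C suc b ≡ K C suc (suc b)
  KC[1+b]≡KC[2+b] = sym (begin
      K C suc (suc b)
    ≡⟨ nCk≡nC[n∸k] (subst (suc (suc b) ≤_) (sym K≡[1+b]+[2+b]) (m≤n+m (suc (suc b)) (suc b))) ⟩
      K C (K ∸ suc (suc b))
    ≡⟨ cong (λ z → K C (z ∸ suc (suc b))) K≡[1+b]+[2+b] ⟩
      K C (suc b + suc (suc b) ∸ suc (suc b))
    ≡⟨ cong (K C_) (m+n∸n≡m (suc b) (suc (suc b))) ⟩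
      K C suc b ∎)
ballot-reflection (suc b) (suc h) = begin
    (X + Y) + suc M C suc b
  ≡⟨ cong (X + Y +_) (sym (nCk+nC[k+1]≡[n+1]C[k+1] M b)) ⟩
    (X + Y) + (M C b + M C suc b)
  ≡⟨ solve 4 (λ x y a c → (x :+ y) :+ (a :+ c) := (y :+ a) :+ (x :+ c)) refl X Y (M C b) (M C suc b) ⟩
    (Y + M C b) + (X + M C suc b)
  ≡⟨ cong₂ _+_ (subst (λ z → ballot z (suc (suc h)) + z C b ≡ z C suc b) [2+h]+2*[1+b]≡M
                      (ballot-reflection b (suc (suc h))))
               (ballot-reflection (suc b) h) ⟩
    M C suc b + M C suc (suc b)
  ≡⟨ nCk+nC[k+1]≡[n+1]C[k+1] M (suc b) ⟩
    suc M C suc (suc b) ∎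
  where
  open ≡-Reasoning
  M = h + 2 * suc (suc b)
  X = ballot M h
  Y = ballot M (suc (suc h))
  [2+h]+2*[1+b]≡M : suc (suc h) + 2 * suc b ≡ M
  [2+h]+2*[1+b]≡M =
    solve 2 (λ h b → (con 2 :+ h) :+ con 2 :* (con 1 :+ b) := h :+ con 2 :* (con 2 :+ b)) refl h b

catalan≡ballot : ∀ k → catalan k ≡ ballot (2 * k) 0
catalan≡ballot zero    = refl
catalan≡ballot (suc b) = trans (cong (_/ suc k) (sym ballot*[1+k]≡NCk)) (m*n/n≡m (ballot N 0) (suc k))
  where
  open ≡-Reasoning
  k = suc b
  N = 2 * k
  N∸b≡1+k : N ∸ b ≡ suc k
  N∸b≡1+k = trans (cong (_∸ b) (solve 1 (λ b → con 2 :* (con 1 :+ b) := (con 2 :+ b) :+ b) refl b))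
                  (m+n∸n≡m (suc k) b)
  ballot*[1+k]≡NCk : ballot N 0 * suc k ≡ N C k
  ballot*[1+k]≡NCk = +-cancelʳ-≡ (k * (N C k)) (ballot N 0 * suc k) (N C k) (begin
      ballot N 0 * suc k + k * (N C k)
    ≡⟨ cong (ballot N 0 * suc k +_) (trans ([1+k]*nC[1+k]≡[n∸k]*nCk N b) (cong (_* (N C b)) N∸b≡1+k)) ⟩
      ballot N 0 * suc k + suc k * (N C b)
    ≡⟨ cong (ballot N 0 * suc k +_) (*-comm (suc k) (N C b)) ⟩
      ballot N 0 * suc k + (N C b) * suc k
    ≡⟨ sym (*-distribʳ-+ (suc k) (ballot N 0) (N C b)) ⟩
      (ballot N 0 + N C b) * suc k
    ≡⟨ cong (_* suc k) (ballot-reflection b 0) ⟩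
      (N C k) * suc k
    ≡⟨ *-comm (N C k) (suc k) ⟩
      N C k + k * (N C k) ∎)

-- Excursions of odd length do not exist, so the first-passage decomposition of excursions becomes Segner's recurrence.
catalan-segner : ∀ n → catalan (suc n) ≡ ∑[ i < suc n ] (catalan i * catalan (n ∸ i))
catalan-segner n = begin
    catalan (suc n)
  ≡⟨ catalan≡ballot (suc n) ⟩
    ballot (2 * suc n) 0
  ≡⟨ cong (λ z → ballot z 0) (*-suc 2 n) ⟩
    ballot (suc (2 * n)) 1
  ≡⟨ ballot-firstPassage (2 * n) 0 ⟩
    ∑[ j < suc (2 * n) ] (ballot j 0 * ballot (2 * n ∸ j) 0)
  ≡⟨ ∑-evens n (λ j → ballot j 0 * ballot (2 * n ∸ j) 0) odd-excursion≡0 ⟩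
    ∑[ i < suc n ] (ballot (2 * i) 0 * ballot (2 * n ∸ 2 * i) 0)
  ≡⟨ ∑-cong (suc n) (λ i _ → cong₂ _*_ (sym (catalan≡ballot i)) (sym (catalan[n∸i] i))) ⟩
    ∑[ i < suc n ] (catalan i * catalan (n ∸ i)) ∎
  where
  open ≡-Reasoning
  odd-excursion≡0 : ∀ i → ballot (suc (2 * i)) 0 * ballot (2 * n ∸ suc (2 * i)) 0 ≡ 0
  odd-excursion≡0 i = cong (_* ballot (2 * n ∸ suc (2 * i)) 0)
    (ballot-odd (suc (2 * i)) 0 (subst Odd (sym (+-identityʳ _)) (Odd-1+2* i)))
  catalan[n∸i] : ∀ i → catalan (n ∸ i) ≡ ballot (2 * n ∸ 2 * i) 0
  catalan[n∸i] i = trans (catalan≡ballot (n ∸ i)) (cong (λ z → ballot z 0) (*-distribˡ-∸ 2 n i))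

catalan-pos : ∀ n → 0 < catalan n
catalan-pos zero    = s≤s z≤n
catalan-pos (suc n) = subst (0 <_) (sym (catalan-segner n))
  (<-≤-trans (subst (0 <_) (sym (+-identityʳ (catalan n))) (catalan-pos n)) (m≤m+n _ _))

-- Rotations of words

entry-++ˡ : ∀ (u w : List ℕ) x → x < length u → entry (u ++ w) x ≡ entry u x
entry-++ˡ (a ∷ u) w zero    _         = refl
entry-++ˡ (a ∷ u) w (suc x) (s≤s x<u) = entry-++ˡ u w x x<u

entry-++ʳ : ∀ (u w : List ℕ) y → entry (u ++ w) (y + length u) ≡ entry w y
entry-++ʳ []      w y = cong (entry w) (+-identityʳ y)
entry-++ʳ (a ∷ u) w y = trans (cong (entry (a ∷ u ++ w)) (+-suc y (length u))) (entry-++ʳ u w y)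

entry-map : ∀ (f : ℕ → ℕ) (u : List ℕ) x → x < length u → entry (map f u) x ≡ f (entry u x)
entry-map f (a ∷ u) zero    _         = refl
entry-map f (a ∷ u) (suc x) (s≤s x<u) = entry-map f u x x<u

-- The position in u ++ m ++ w of the entry at position y of u ++ w, when length u = a and length m = l.
skipBlock : ℕ → ℕ → ℕ → ℕ
skipBlock zero    l y       = y + l
skipBlock (suc a) l zero    = zero
skipBlock (suc a) l (suc y) = suc (skipBlock a l y)

skipBlock-injective : ∀ a l y z → skipBlock a l y ≡ skipBlock a l z → y ≡ z
skipBlock-injective zero    l y       z       eq = +-cancelʳ-≡ l y z eq
skipBlock-injective (suc a) l zero    zero    eq = refl
skipBlock-injective (suc a) l (suc y) (suc z) eq = cong suc (skipBlock-injective a l y z (suc-injective eq))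

entry-skipBlock : ∀ (u m w : List ℕ) y →
                  entry (u ++ m ++ w) (skipBlock (length u) (length m) y) ≡ entry (u ++ w) y
entry-skipBlock []      m w y       = entry-++ʳ m w y
entry-skipBlock (a ∷ u) m w zero    = refl
entry-skipBlock (a ∷ u) m w (suc y) = entry-skipBlock u m w y

skipBlock-< : ∀ (u m w : List ℕ) y → y < length (u ++ w) →
              skipBlock (length u) (length m) y < length (u ++ m ++ w)
skipBlock-< []      m w y       y<w =
  subst (y + length m <_) (trans (+-comm (length w) (length m)) (sym (length-++ m))) (+-monoˡ-< (length m) y<w)
skipBlock-< (a ∷ u) m w zero    _          = s≤s z≤n
skipBlock-< (a ∷ u) m w (suc y) (s≤s y<uw) = s≤s (skipBlock-< u m w y y<uw)

skipBlock-cover : ∀ (u u′ m w w′ : List ℕ) → length u ≡ length u′ →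
  ∀ x → x < length (u ++ m ++ w) →
  (Σ ℕ λ y → x ≡ skipBlock (length u) (length m) y × y < length (u ++ w)) ⊎
  (entry (u ++ m ++ w) x ≡ entry (u′ ++ m ++ w′) x)
skipBlock-cover [] [] m w w′ _ x x<mw with x <? length m
... | yes x<m = inj₂ (trans (entry-++ˡ m w x x<m) (sym (entry-++ˡ m w′ x x<m)))
... | no  x≮m = inj₁ (x ∸ length m , sym x≡[x∸m]+m ,
        +-cancelʳ-< (length m) (x ∸ length m) (length w)
          (subst₂ _<_ (sym x≡[x∸m]+m) (trans (length-++ m) (+-comm (length m) (length w))) x<mw))
  where
  x≡[x∸m]+m : x ∸ length m + length m ≡ x
  x≡[x∸m]+m = m∸n+n≡m (≮⇒≥ x≮m)
skipBlock-cover (a ∷ u) (a′ ∷ u′) m w w′ _  zero    _ = inj₁ (0 , refl , s≤s z≤n)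
skipBlock-cover (a ∷ u) (a′ ∷ u′) m w w′ eq (suc x) (s≤s x<umw)
  with skipBlock-cover u u′ m w w′ (suc-injective eq) x x<umw
... | inj₁ (y , x≡ , y<) = inj₁ (suc y , cong suc x≡ , s≤s y<)
... | inj₂ same          = inj₂ same

module _ {k : ℕ} where

  private
    m : ℕ
    m = suc (suc k)

  RotationOf-insert : ∀ (u u′ mid w w′ : List ℕ) → length u ≡ length u′ →
    RotationOf k (u ++ w) (u′ ++ w′) → RotationOf k (u ++ mid ++ w) (u′ ++ mid ++ w′)
  RotationOf-insert u u′ mid w w′ u≡u′ (len , p , p-inj , p< , rotate , fix) =
    len′ , p′ , p′-inj , p′< , rotate′ , fix′
    where
    skip : ℕ → ℕ
    skip = skipBlock (length u) (length mid)
    p′ : ℕ → ℕ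
    p′ = skip ∘ p
    w≡w′ : length w ≡ length w′
    w≡w′ = +-cancelˡ-≡ (length u′) (length w) (length w′)
      (trans (cong (_+ length w) (sym u≡u′)) (trans (sym (length-++ u)) (trans len (length-++ u′))))
    len′ : length (u ++ mid ++ w) ≡ length (u′ ++ mid ++ w′)
    len′ = trans (length-++ u) (trans (cong₂ _+_ u≡u′ (trans (length-++ mid)
      (trans (cong (length mid +_) w≡w′) (sym (length-++ mid))))) (sym (length-++ u′)))
    p′-inj : ∀ s t → s < m → t < m → p′ s ≡ p′ t → s ≡ t
    p′-inj s t s<m t<m eq = p-inj s t s<m t<m (skipBlock-injective (length u) (length mid) (p s) (p t) eq)
    p′< : ∀ t → t < m → p′ t < length (u ++ mid ++ w)
    p′< t t<m = skipBlock-< u mid w (p t) (p< t t<m)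
    entry′-skip : ∀ y → entry (u′ ++ mid ++ w′) (skip y) ≡ entry (u′ ++ w′) y
    entry′-skip y rewrite u≡u′ = entry-skipBlock u′ mid w′ y
    rotate′ : ∀ t → t < m → entry (u′ ++ mid ++ w′) (p′ (suc t % m)) ≡ entry (u ++ mid ++ w) (p′ t)
    rotate′ t t<m = trans (entry′-skip _) (trans (rotate t t<m) (sym (entry-skipBlock u mid w (p t))))
    fix′ : ∀ x → x < length (u ++ mid ++ w) → (∀ t → t < m → x ≢ p′ t) →
           entry (u′ ++ mid ++ w′) x ≡ entry (u ++ mid ++ w) x
    fix′ x x< x∉p′ with skipBlock-cover u u′ mid w w′ u≡u′ x x<
    ... | inj₂ same            = sym same
    ... | inj₁ (y , refl , y<) = trans (entry′-skip y)
      (trans (fix y y< (λ t t<m y≡pt → x∉p′ t t<m (cong skip y≡pt))) (sym (entry-skipBlock u mid w y)))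

  RotationOf-prefix : ∀ (w u v : List ℕ) → RotationOf k u v → RotationOf k (w ++ u) (w ++ v)
  RotationOf-prefix w u v = RotationOf-insert [] [] w u v refl

  RotationOf-suffix : ∀ (w u v : List ℕ) → RotationOf k u v → RotationOf k (u ++ w) (v ++ w)
  RotationOf-suffix w u v r = subst₂ (RotationOf k) (cong (u ++_) (++-identityʳ w)) (cong (v ++_) (++-identityʳ w))
    (RotationOf-insert u v w [] [] (proj₁ r)
      (subst₂ (RotationOf k) (sym (++-identityʳ u)) (sym (++-identityʳ v)) r))

  RotationOf-shift : ∀ l (u v : List ℕ) → RotationOf k u v → RotationOf k (shift l u) (shift l v)
  RotationOf-shift l u v (len , p , p-inj , p< , rotate , fix) = len′ , p , p-inj , p′< , rotate′ , fix′
    where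
    open ≡-Reasoning
    u≡lu : length u ≡ length (shift l u)
    u≡lu = sym (length-map (_+ l) u)
    len′ = trans (sym u≡lu) (trans len (sym (length-map (_+ l) v)))
    p′< : ∀ t → t < m → p t < length (shift l u)
    p′< t t<m = subst (p t <_) u≡lu (p< t t<m)
    rotate′ : ∀ t → t < m → entry (shift l v) (p (suc t % m)) ≡ entry (shift l u) (p t)
    rotate′ t t<m = begin
        entry (shift l v) (p (suc t % m))
      ≡⟨ entry-map (_+ l) v _ (subst (p (suc t % m) <_) len (p< _ (m%n<n (suc t) m))) ⟩
        entry v (p (suc t % m)) + l
      ≡⟨ cong (_+ l) (rotate t t<m) ⟩
        entry u (p t) + l
      ≡⟨ entry-map (_+ l) u _ (p< t t<m) ⟨
        entry (shift l u) (p t) ∎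
    fix′ : ∀ x → x < length (shift l u) → (∀ t → t < m → x ≢ p t) →
           entry (shift l v) x ≡ entry (shift l u) x
    fix′ x x< x∉p = begin
        entry (shift l v) x  ≡⟨ entry-map (_+ l) v x (subst (x <_) len x<u) ⟩
        entry v x + l        ≡⟨ cong (_+ l) (fix x x<u x∉p) ⟩
        entry u x + l        ≡⟨ entry-map (_+ l) u x x<u ⟨
        entry (shift l u) x  ∎
      where
      x<u = subst (x <_) (sym u≡lu) x<

  -- The inverse rotation visits the same positions backwards.
  RotationOf-sym : ∀ (u v : List ℕ) → RotationOf k u v → RotationOf k v u
  RotationOf-sym u v (len , p , p-inj , p< , rotate , fix) = sym len , p′ , p′-inj , p′< , rotate′ , fix′
    where
    p′ : ℕ → ℕ
    p′ t = p (suc k ∸ t)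
    back< : ∀ t → suc k ∸ t < m
    back< t = s≤s (m∸n≤m (suc k) t)
    p′-inj : ∀ s t → s < m → t < m → p′ s ≡ p′ t → s ≡ t
    p′-inj s t s<m t<m eq = ∸-cancelˡ-≡ (≤-pred s<m) (≤-pred t<m) (p-inj _ _ (back< s) (back< t) eq)
    p′< : ∀ t → t < m → p′ t < length v
    p′< t t<m = subst (p′ t <_) len (p< _ (back< t))
    rotate′ : ∀ t → t < m → entry u (p′ (suc t % m)) ≡ entry v (p′ t)
    rotate′ t t<m with t ≟ suc k
    ... | yes refl = trans (cong (λ z → entry u (p (suc k ∸ z))) (n%n≡0 m))
      (trans (sym (rotate (suc k) t<m)) (cong (λ z → entry v (p z)) (trans (n%n≡0 m) (sym (n∸n≡0 k)))))
    ... | no  t≢1+k = trans (cong (λ z → entry u (p (suc k ∸ z))) (m<n⇒m%n≡m (s≤s t≤k)))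
      (trans (sym (rotate (k ∸ t) (s≤s (m≤n⇒m≤1+n (m∸n≤m k t)))))
             (cong (λ z → entry v (p z)) (trans (m<n⇒m%n≡m (s≤s (s≤s (m∸n≤m k t))))
                                                (sym (+-∸-assoc 1 (≤-pred t≤k))))))
      where
      t≤k : t < suc k
      t≤k = ≤∧≢⇒< (≤-pred t<m) t≢1+k
    fix′ : ∀ x → x < length v → (∀ t → t < m → x ≢ p′ t) → entry u x ≡ entry v x
    fix′ x x< x∉p′ = sym (fix x (subst (x <_) (sym len) x<)
      (λ s s<m x≡ps → x∉p′ (suc k ∸ s) (back< s)
                        (trans x≡ps (cong p (sym (m∸[m∸n]≡n (≤-pred s<m)))))))

  RotationOf-rotateRight : ∀ (u : List ℕ) x → length u ≡ suc k → RotationOf k (u ∷ʳ x) (x ∷ u)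
  RotationOf-rotateRight u x |u|≡1+k =
    len , (λ t → t) , (λ s t _ _ s≡t → s≡t) , (λ t t<m → subst (t <_) (sym |u∷ʳx|≡m) t<m) ,
    rotate , (λ y y< y∉ → ⊥-elim (y∉ y (subst (y <_) |u∷ʳx|≡m y<) refl))
    where
    len : length (u ∷ʳ x) ≡ length (x ∷ u)
    len = trans (length-++ u) (+-comm (length u) 1)
    |u∷ʳx|≡m : length (u ∷ʳ x) ≡ m
    |u∷ʳx|≡m = trans len (cong suc |u|≡1+k)
    rotate : ∀ t → t < m → entry (x ∷ u) (suc t % m) ≡ entry (u ∷ʳ x) t
    rotate t t<m with t ≟ suc k
    ... | yes refl = trans (cong (entry (x ∷ u)) (n%n≡0 m))
      (sym (subst (λ z → entry (u ∷ʳ x) z ≡ x) |u|≡1+k (entry-++ʳ u [ x ] 0)))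
    ... | no  t≢1+k = trans (cong (entry (x ∷ u)) (m<n⇒m%n≡m (s≤s t<1+k)))
      (sym (entry-++ˡ u [ x ] t (subst (t <_) (sym |u|≡1+k) t<1+k)))
      where
      t<1+k : t < suc k
      t<1+k = ≤∧≢⇒< (≤-pred t<m) t≢1+k

Rotation234-prefix : ∀ w {u v} → Rotation234 u v → Rotation234 (w ++ u) (w ++ v)
Rotation234-prefix w {u} {v} = map₂ (map₂ (RotationOf-prefix w u v))

Rotation234-suffix : ∀ w {u v} → Rotation234 u v → Rotation234 (u ++ w) (v ++ w)
Rotation234-suffix w {u} {v} = map₂ (map₂ (RotationOf-suffix w u v))

Rotation234-shift : ∀ l {u v} → Rotation234 u v → Rotation234 (shift l u) (shift l v)
Rotation234-shift l {u} {v} = map₂ (map₂ (RotationOf-shift l u v))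

Rotation234-sym : Symmetric Rotation234
Rotation234-sym {u} {v} = map₂ (map₂ (RotationOf-sym u v))

junction-append : ∀ u N z x w → length z ≤ 1 →
                  Rotation234 (u ++ N ∷ z ++ x ∷ w) ((u ++ [ x ]) ++ N ∷ z ++ w)
junction-append u N z x w |z|≤1 = length z , ≤-trans |z|≤1 (s≤s z≤n) ,
  subst₂ (RotationOf (length z))
    (cong (λ v → u ++ N ∷ v) (++-assoc z [ x ] w))
    (sym (++-assoc u [ x ] (N ∷ z ++ w)))
    (RotationOf-prefix u _ _ (RotationOf-suffix w _ _ (RotationOf-rotateRight (N ∷ z) x refl)))

junction-swapEnds : ∀ y m N z x w → length z ≤ 1 →
                    Rotation234 ((y ∷ m) ++ N ∷ z ++ x ∷ w) ((x ∷ m ++ [ y ]) ++ N ∷ z ++ w)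
junction-swapEnds y m N z x w |z|≤1 = suc (length z) , s≤s |z|≤1 ,
  subst₂ (RotationOf (suc (length z)))
    (cong (λ v → y ∷ m ++ N ∷ v) (++-assoc z [ x ] w))
    (cong (x ∷_) (sym (++-assoc m [ y ] (N ∷ z ++ w))))
    (RotationOf-insert [ y ] [ x ] m _ _ refl (RotationOf-suffix w _ _ (RotationOf-rotateRight (y ∷ N ∷ z) x refl)))

data Chain {X : Set} (R : X → X → Set) : X → X → List X → Set where
  single : ∀ x → Chain R x x [ x ]
  link   : ∀ {x y z xs} → R x y → Chain R y z xs → Chain R x z (x ∷ xs)

range1-suc : ∀ c → range1 (suc c) ≡ 1 ∷ map suc (range1 c)
range1-suc c = cong (λ l → 1 ∷ map suc l) (sym (map-applyUpTo (λ k → k) suc c))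

length-map-range1 : {X : Set} (g : ℕ → X) → ∀ c → length (map g (range1 c)) ≡ c
length-map-range1 g c =
  trans (length-map g (range1 c)) (trans (length-map suc (applyUpTo (λ k → k) c)) (length-applyUpTo _ c))

length-concatMap-range1 : {X : Set} (G : ℕ → List X) → ∀ c →
                          length (concatMap G (range1 c)) ≡ ∑[ k < c ] length (G (suc k))
length-concatMap-range1 G zero    = refl
length-concatMap-range1 G (suc c) = begin
    length (concatMap G (range1 (suc c)))
  ≡⟨ cong (length ∘ concatMap G) (range1-suc c) ⟩
    length (G 1 ++ concatMap G (map suc (range1 c)))
  ≡⟨ length-++ (G 1) ⟩
    length (G 1) + length (concatMap G (map suc (range1 c)))
  ≡⟨ cong (λ l → length (G 1) + length l) (concatMap-map G suc (range1 c)) ⟩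
    length (G 1) + length (concatMap (G ∘ suc) (range1 c))
  ≡⟨ cong (length (G 1) +_) (length-concatMap-range1 (G ∘ suc) c) ⟩
    ∑[ k < suc c ] length (G (suc k)) ∎
  where open ≡-Reasoning

module _ {X : Set} {R : X → X → Set} where

  chain-++ : ∀ {a b c d xs ys} → Chain R a b xs → R b c → Chain R c d ys → Chain R a d (xs ++ ys)
  chain-++ (single x)   r ys = link r ys
  chain-++ (link r′ xs) r ys = link r′ (chain-++ xs r ys)

  chain-first : ∀ {a b xs} (d : X) → Chain R a b xs → at d xs 1 ≡ a
  chain-first d (single x)  = refl
  chain-first d (link r xs) = refl

  chain-last : ∀ {a b xs} (d : X) → Chain R a b xs → at d xs (length xs) ≡ b
  chain-last d (single x)            = refl
  chain-last d (link r (single y))   = refl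
  chain-last d (link r (link r′ xs)) = chain-last d (link r′ xs)

  chain-adjacent : ∀ {a b xs} (d : X) → Chain R a b xs →
                   ∀ q → 1 ≤ q → suc q ≤ length xs → R (at d xs q) (at d xs (suc q))
  chain-adjacent d (single x)            1             _ (s≤s ())
  chain-adjacent d (link r xs)           1             _ _ = subst (R _) (sym (chain-first d xs)) r
  chain-adjacent d (link r (single y))   (suc (suc q)) _ (s≤s (s≤s ()))
  chain-adjacent d (link r (link r′ xs)) (suc (suc q)) _ (s≤s q<) =
    chain-adjacent d (link r′ xs) (suc q) (s≤s z≤n) q<

  chain-reverse : Symmetric R → ∀ {a b xs} → Chain R a b xs → Chain R b a (reverse xs)
  chain-reverse sym-R (single x) = single x
  chain-reverse sym-R (link {x = x} {xs = xs} r rest) =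
    subst (Chain R _ _) (sym (unfold-reverse x xs)) (chain-++ (chain-reverse sym-R rest) (sym-R r) (single x))

  chain-map-range1 : (g : ℕ → X) → ∀ c → 1 ≤ c →
                     (∀ k → 1 ≤ k → suc k ≤ c → R (g k) (g (suc k))) →
                     Chain R (g 1) (g c) (map g (range1 c))
  chain-map-range1 g 1             _ adj = single (g 1)
  chain-map-range1 g (suc (suc c)) _ adj = subst (Chain R _ _) (cong (map g) (sym (range1-suc (suc c))))
    (link (adj 1 ≤-refl (s≤s (s≤s z≤n))) (subst (Chain R _ _) (map-∘ (range1 (suc c)))
      (chain-map-range1 (g ∘ suc) (suc c) (s≤s z≤n) (λ k _ k<c → adj (suc k) (s≤s z≤n) (s≤s k<c)))))

  chain-concatMap-range1 : (G : ℕ → List X) (first last : ℕ → X) → ∀ c → 1 ≤ c →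
    (∀ j → 1 ≤ j → j ≤ c → Chain R (first j) (last j) (G j)) →
    (∀ j → 1 ≤ j → suc j ≤ c → R (last j) (first (suc j))) →
    Chain R (first 1) (last c) (concatMap G (range1 c))
  chain-concatMap-range1 G first last 1             _ blocks joins =
    subst (Chain R _ _) (sym (++-identityʳ (G 1))) (blocks 1 ≤-refl ≤-refl)
  chain-concatMap-range1 G first last (suc (suc c)) _ blocks joins =
    subst (Chain R _ _) (cong (concatMap G) (sym (range1-suc (suc c))))
      (chain-++ (blocks 1 ≤-refl (s≤s z≤n)) (joins 1 ≤-refl (s≤s (s≤s z≤n)))
        (subst (Chain R _ _) (sym (concatMap-map G suc (range1 (suc c))))
          (chain-concatMap-range1 (G ∘ suc) (first ∘ suc) (last ∘ suc) (suc c) (s≤s z≤n)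
            (λ j _ j≤c → blocks (suc j) (s≤s z≤n) (s≤s j≤c))
            (λ j _ j<c → joins (suc j) (s≤s z≤n) (s≤s j<c)))))

-- The ends of D m and the induction step

shift-0 : ∀ w → shift 0 w ≡ w
shift-0 w = trans (map-cong +-identityʳ w) (map-id w)

ascending : ℕ → List ℕ
ascending zero    = []
ascending (suc m) = ascending m ∷ʳ suc m

maxFirst : ℕ → List ℕ
maxFirst zero    = []
maxFirst (suc m) = suc m ∷ ascending m

shift-ascending : ∀ i m → shift i (ascending (suc m)) ≡ suc i ∷ shift (suc i) (ascending m)
shift-ascending i zero    = refl
shift-ascending i (suc m) = begin
    shift i (ascending (suc m) ∷ʳ suc (suc m))
  ≡⟨ map-++ (_+ i) (ascending (suc m)) [ suc (suc m) ] ⟩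
    shift i (ascending (suc m)) ++ [ suc (suc m) + i ]
  ≡⟨ cong₂ (λ w x → w ++ [ x ]) (shift-ascending i m) (sym (+-suc (suc m) i)) ⟩
    suc i ∷ shift (suc i) (ascending m) ++ [ suc m + suc i ]
  ≡⟨ cong (suc i ∷_) (sym (map-++ (_+ suc i) (ascending m) [ suc m ])) ⟩
    suc i ∷ shift (suc i) (ascending (suc m)) ∎
  where open ≡-Reasoning

-- The last word of D m when D m is read forwards (true) or backwards (false).
lastOf : Bool → ℕ → List ℕ
lastOf b m = if b then ascending m else maxFirst m

firstOf : Bool → ℕ → List ℕ
firstOf b = lastOf (not b)

lastOf-0 : ∀ b → lastOf b 0 ≡ []
lastOf-0 true  = refl
lastOf-0 false = refl

lastOf-suc : ∀ b i → (lastOf b (suc i) ≡ lastOf b i ++ [ suc i ]) ⊎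
  (Σ (List ℕ) λ w → lastOf b i ≡ i ∷ w × lastOf b (suc i) ≡ suc i ∷ w ++ [ i ])
lastOf-suc true  i       = inj₁ refl
lastOf-suc false zero    = inj₁ refl
lastOf-suc false (suc i) = inj₂ (ascending i , refl , refl)

shift-lastOf-suc : ∀ b i m → Σ (List ℕ) λ z → Σ (List ℕ) λ w → length z ≤ 1 ×
  shift i (lastOf b (suc m)) ≡ z ++ suc i ∷ w × shift (suc i) (lastOf b m) ≡ z ++ w
shift-lastOf-suc true  i m       = [] , _ , z≤n , shift-ascending i m , refl
shift-lastOf-suc false i zero    = [] , _ , z≤n , shift-ascending i zero , refl
shift-lastOf-suc false i (suc m) = [ suc (suc m) + i ] , shift (suc i) (ascending m) , ≤-refl ,
  cong (suc (suc m) + i ∷_) (shift-ascending i m) , cong (_∷ shift (suc i) (ascending m)) (+-suc (suc m) i)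

junction : ∀ a b i m N → Rotation234 (lastOf a i ++ N ∷ shift i (lastOf b (suc m)))
                                     (lastOf a (suc i) ++ N ∷ shift (suc i) (lastOf b m))
junction a b i m N with lastOf-suc a i | shift-lastOf-suc b i m
... | inj₁ left | z , w , |z|≤1 , right , right′
  rewrite left | right | right′ = junction-append (lastOf a i) N z (suc i) w |z|≤1
... | inj₂ (v , left , left′) | z , w , |z|≤1 , right , right′
  rewrite left | left′ | right | right′ = junction-swapEnds i v N z (suc i) w |z|≤1

isOdd-suc : ∀ n → isOdd (suc n) ≡ not (isOdd n)
isOdd-suc n with isOdd n
... | true  = refl
... | false = refl

isOdd-n+n : ∀ n → isOdd (n + n) ≡ false
isOdd-n+n zero    = refl
isOdd-n+n (suc n) = begin
    isOdd (suc (n + suc n))    ≡⟨ cong (isOdd ∘ suc) (+-suc n n) ⟩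
    isOdd (suc (suc (n + n)))  ≡⟨ isOdd-suc (suc (n + n)) ⟩
    not (isOdd (suc (n + n)))  ≡⟨ cong not (isOdd-suc (n + n)) ⟩
    not (not (isOdd (n + n)))  ≡⟨ not-involutive _ ⟩
    isOdd (n + n)              ≡⟨ isOdd-n+n n ⟩
    false                      ∎
  where open ≡-Reasoning

isOdd-n+[1+n] : ∀ n → isOdd (n + suc n) ≡ true
isOdd-n+[1+n] n = trans (cong isOdd (+-suc n n)) (trans (isOdd-suc (n + n)) (cong not (isOdd-n+n n)))

firstOf-isOdd-suc : ∀ p m → firstOf (isOdd (suc p)) m ≡ lastOf (isOdd p) m
firstOf-isOdd-suc p m =
  trans (cong (λ b → lastOf (not b) m) (isOdd-suc p)) (cong (λ b → lastOf b m) (not-involutive (isOdd p)))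

A-suc : ∀ i → A (suc (suc i)) ≡ A (suc i) + catalan i
A-suc i = begin
    sum (map catalan (upTo (suc i)))             ≡⟨ cong (sum ∘ map catalan) (applyUpTo-∷ʳ (λ k → k) i) ⟨
    sum (map catalan (upTo i ∷ʳ i))              ≡⟨ cong sum (map-++ catalan (upTo i) [ i ]) ⟩
    sum (map catalan (upTo i) ++ [ catalan i ])  ≡⟨ sum-++ (map catalan (upTo i)) [ catalan i ] ⟩
    A (suc i) + (catalan i + 0)                  ≡⟨ cong (A (suc i) +_) (+-identityʳ (catalan i)) ⟩
    A (suc i) + catalan i                        ∎
  where open ≡-Reasoning

IsRotationGray : ℕ → List (List ℕ) → Set
IsRotationGray m X = Chain Rotation234 (maxFirst m) (ascending m) X × length X ≡ catalan m

module _ {m : ℕ} {X : List (List ℕ)} (gray : IsRotationGray m X) where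

  private
    chain-pow : ∀ p → Chain Rotation234 (firstOf (isOdd p) m) (lastOf (isOdd p) m) (pow p X)
    chain-pow p with isOdd p
    ... | true  = proj₁ gray
    ... | false = chain-reverse (λ {u v} → Rotation234-sym {u} {v}) (proj₁ gray)

    length-pow : ∀ p → length (pow p X) ≡ catalan m
    length-pow p with isOdd p
    ... | true  = proj₂ gray
    ... | false = trans (length-reverse X) (proj₂ gray)

  pow-first : ∀ p → at [] (pow p X) 1 ≡ firstOf (isOdd p) m
  pow-first p = chain-first [] (chain-pow p)

  pow-last : ∀ p → at [] (pow p X) (catalan m) ≡ lastOf (isOdd p) m
  pow-last p = subst (λ c → at [] (pow p X) c ≡ lastOf (isOdd p) m) (length-pow p) (chain-last [] (chain-pow p))

  pow-adjacent : ∀ p k → 1 ≤ k → suc k ≤ catalan m →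
                 Rotation234 (at [] (pow p X) k) (at [] (pow p X) (suc k))
  pow-adjacent p k 1≤k k<c = chain-adjacent [] (chain-pow p) k 1≤k (subst (suc k ≤_) (sym (length-pow p)) k<c)

module Construction (n′ : ℕ) (E : ℕ → List (List ℕ))
                    (E-gray : ∀ m → m ≤ n′ → IsRotationGray m (E m)) where

  private
    n = suc n′

  word : ℕ → ℕ → ℕ → List ℕ
  word i j k =
    at [] (pow (n + i ∸ 1) (E (i ∸ 1))) j ++ [ n ] ++ shift (i ∸ 1) (at [] (pow (j + A i + 1) (E (n ∸ i))) k)

  inner : ℕ → ℕ → List (List ℕ)
  inner i j = map (word i j) (range1 (catalan (n ∸ i)))

  outer : ℕ → List (List ℕ)
  outer i = concatMap (inner i) (range1 (catalan (i ∸ 1)))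

  right-gray : ∀ i → IsRotationGray (n′ ∸ i) (E (n′ ∸ i))
  right-gray i = E-gray (n′ ∸ i) (m∸n≤m n′ i)

  inner-chain : ∀ i j →
    Chain Rotation234 (word (suc i) j 1) (word (suc i) j (catalan (n′ ∸ i))) (inner (suc i) j)
  inner-chain i j = chain-map-range1 (word (suc i) j) (catalan (n′ ∸ i)) (catalan-pos (n′ ∸ i))
    (λ k 1≤k k<c → Rotation234-prefix (at [] (pow (n + suc i ∸ 1) (E i)) j) (Rotation234-prefix [ n ]
                     (Rotation234-shift i {β k} {β (suc k)} (pow-adjacent (right-gray i) p k 1≤k k<c))))
    where
    p = j + A (suc i) + 1
    β : ℕ → List ℕ
    β k = at [] (pow p (E (n′ ∸ i))) k

  -- The right factor ends where its reversed next copy starts, so only the left factor moves.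
  inner-junction : ∀ i j → i ≤ n′ → 1 ≤ j → suc j ≤ catalan i →
    Rotation234 (word (suc i) j (catalan (n′ ∸ i))) (word (suc i) (suc j) 1)
  inner-junction i j i≤n′ 1≤j j<c =
    subst (λ w → Rotation234 (word (suc i) j (catalan (n′ ∸ i))) (α (suc j) ++ [ n ] ++ shift i w))
      β-last≡β′-first
      (Rotation234-suffix ([ n ] ++ shift i (at [] (pow p (E (n′ ∸ i))) (catalan (n′ ∸ i))))
        {α j} {α (suc j)} (pow-adjacent (E-gray i i≤n′) (n + suc i ∸ 1) j 1≤j j<c))
    where
    p = j + A (suc i) + 1
    α : ℕ → List ℕ
    α j = at [] (pow (n + suc i ∸ 1) (E i)) j
    β-last≡β′-first : at [] (pow p (E (n′ ∸ i))) (catalan (n′ ∸ i))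
                    ≡ at [] (pow (suc p) (E (n′ ∸ i))) 1
    β-last≡β′-first = trans (pow-last (right-gray i) p)
      (sym (trans (pow-first (right-gray i) (suc p)) (firstOf-isOdd-suc p (n′ ∸ i))))

  outer-chain : ∀ i → i ≤ n′ →
    Chain Rotation234 (word (suc i) 1 1) (word (suc i) (catalan i) (catalan (n′ ∸ i))) (outer (suc i))
  outer-chain i i≤n′ =
    chain-concatMap-range1 (inner (suc i)) (λ j → word (suc i) j 1) (λ j → word (suc i) j (catalan (n′ ∸ i)))
      (catalan i) (catalan-pos i) (λ j _ _ → inner-chain i j) (λ j → inner-junction i j i≤n′)

  outer-junction : ∀ i → suc i ≤ n′ →
    Rotation234 (word (suc i) (catalan i) (catalan (n′ ∸ i))) (word (suc (suc i)) 1 1)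
  outer-junction i i<n′ = subst₂ Rotation234 (sym last≡) (sym first≡) (junction a b i m n)
    where
    m = n′ ∸ suc i
    a = isOdd (n′ + suc i)
    b = isOdd (catalan i + A (suc i) + 1)
    last≡ : word (suc i) (catalan i) (catalan (n′ ∸ i)) ≡ lastOf a i ++ n ∷ shift i (lastOf b (suc m))
    last≡ = cong₂ (λ x y → x ++ [ n ] ++ shift i y)
      (pow-last (E-gray i (≤-trans (n≤1+n i) i<n′)) (n′ + suc i))
      (trans (pow-last (right-gray i) (catalan i + A (suc i) + 1)) (cong (lastOf b) (+-∸-assoc 1 i<n′)))
    left≡ : firstOf (isOdd (n′ + suc (suc i))) (suc i) ≡ lastOf a (suc i)
    left≡ = trans (cong (λ z → firstOf (isOdd z) (suc i)) (+-suc n′ (suc i)))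
                  (firstOf-isOdd-suc (n′ + suc i) (suc i))
    right≡ : firstOf (isOdd (1 + A (suc (suc i)) + 1)) m ≡ lastOf b m
    right≡ = trans (firstOf-isOdd-suc (A (suc (suc i)) + 1) m)
      (cong (λ z → lastOf (isOdd (z + 1)) m) (trans (A-suc i) (+-comm (A (suc i)) (catalan i))))
    first≡ : word (suc (suc i)) 1 1 ≡ lastOf a (suc i) ++ n ∷ shift (suc i) (lastOf b m)
    first≡ = cong₂ (λ x y → x ++ [ n ] ++ shift (suc i) y)
      (trans (pow-first (E-gray (suc i) i<n′) (n′ + suc (suc i))) left≡)
      (trans (pow-first (E-gray m (m∸n≤m n′ (suc i))) (1 + A (suc (suc i)) + 1)) right≡)

  step-chain : Chain Rotation234 (word 1 1 1) (word n (catalan n′) (catalan (n′ ∸ n′))) (step n E)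
  step-chain =
    chain-concatMap-range1 outer (λ i → word i 1 1) (λ i → word i (catalan (i ∸ 1)) (catalan (n ∸ i)))
      n (s≤s z≤n)
      (λ { (suc i) _ (s≤s i≤n′) → outer-chain i i≤n′ })
      (λ { (suc i) _ (s≤s i<n′) → outer-junction i i<n′ })

  step-first : word 1 1 1 ≡ maxFirst n
  step-first = cong₂ (λ x y → x ++ [ n ] ++ y)
    (trans (pow-first (E-gray 0 z≤n) (n + 1 ∸ 1)) (lastOf-0 (not (isOdd (n + 1 ∸ 1)))))
    (trans (shift-0 _) (pow-first (E-gray n′ ≤-refl) 2))

  step-last : word n (catalan n′) (catalan (n′ ∸ n′)) ≡ ascending n
  step-last = cong₂ (λ x y → x ++ [ n ] ++ shift n′ y)
    (trans (pow-last (E-gray n′ ≤-refl) (n′ + n)) (cong (λ b → lastOf b n′) (isOdd-n+[1+n] n′)))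
    (trans (pow-last (right-gray n′) (catalan n′ + A n + 1))
           (trans (cong (lastOf _) (n∸n≡0 n′)) (lastOf-0 _)))

  length-step : length (step n E) ≡ catalan n
  length-step = begin
      length (step n E)
    ≡⟨ length-concatMap-range1 outer n ⟩
      ∑[ i < n ] length (outer (suc i))
    ≡⟨ ∑-cong n (λ i _ → length-concatMap-range1 (inner (suc i)) (catalan i)) ⟩
      ∑[ i < n ] ∑[ j < catalan i ] length (inner (suc i) (suc j))
    ≡⟨ ∑-cong n (λ i _ → ∑-cong (catalan i) (λ j _ →
         length-map-range1 (word (suc i) (suc j)) (catalan (n′ ∸ i)))) ⟩
      ∑[ i < n ] ∑[ j < catalan i ] catalan (n′ ∸ i)
    ≡⟨ ∑-cong n (λ i _ → ∑-const (catalan i) (catalan (n′ ∸ i))) ⟩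
      ∑[ i < n ] (catalan i * catalan (n′ ∸ i))
    ≡⟨ catalan-segner n′ ⟨
      catalan n ∎
    where open ≡-Reasoning

  step-gray : IsRotationGray n (step n E)
  step-gray = subst₂ (λ x y → Chain Rotation234 x y (step n E)) step-first step-last step-chain , length-step

Dupto-below : ∀ n m → m ≤ n → Dupto (suc n) m ≡ Dupto n m
Dupto-below n m m≤n rewrite Equivalence.to T-≡ (≤⇒≤ᵇ m≤n) = refl

Dupto≡D : ∀ n m → m ≤ n → Dupto n m ≡ D m
Dupto≡D n m m≤n with m≤n⇒m<n∨m≡n m≤n
... | inj₁ (s≤s m≤n′) = trans (Dupto-below _ m m≤n′) (Dupto≡D _ m m≤n′)
... | inj₂ refl       = refl

D-suc : ∀ n → D (suc n) ≡ step (suc n) (Dupto n)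
D-suc n with suc n ≤ᵇ n | ≤ᵇ⇒≤ (suc n) n
... | false | _     = refl
... | true  | 1+n≤n = ⊥-elim (n≮n n (1+n≤n _))

D-gray : ∀ m → IsRotationGray m (D m)
D-gray = <-rec (λ m → IsRotationGray m (D m)) gray
  where
  gray : ∀ m → (∀ {k} → k < m → IsRotationGray k (D k)) → IsRotationGray m (D m)
  gray zero    _       = single [] , refl
  gray (suc n) smaller = subst (IsRotationGray (suc n)) (sym (D-suc n))
    (Construction.step-gray n (Dupto n)
      (λ m m≤n → subst (IsRotationGray m) (sym (Dupto≡D n m m≤n)) (smaller (s≤s m≤n))))

theorem2p3 : (n : ℕ) → 1 ≤ n → (q : ℕ) → 1 ≤ q → q < catalan n →
    Rotation234 (Dat n q) (Dat n (q + 1))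
theorem2p3 n _ q 1≤q q<c = subst (λ r → Rotation234 (Dat n q) (Dat n r)) (+-comm 1 q)
  (chain-adjacent [] (proj₁ (D-gray n)) q 1≤q (subst (suc q ≤_) (sym (proj₂ (D-gray n))) q<c))
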